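{- Let $k$ be a positive integer, let $\mathcal{C}_1,\dots,\mathcal{C}_t$ be intersectionwise $\chi$-guarding classes, and let $\mathcal{C}$ be a class of graphs such that every $G\in\mathcal{C}$ has a $k$-coloring $f:V(G)\to[k]$ (not necessarily proper) such that for every $j\in[k]$ there exists $i\in[t]$ with $G[f^{ -1}(j)]\in\mathcal{C}_i$. Then $\mathcal{C}$ is intersectionwise $\chi$-guarding.
   Context: All graphs are finite and simple; graph classes are hereditary. The graph-intersection of classes $\mathcal{A},\mathcal{B}$ is the class of all graphs $(V(G)\cap V(H),E(G)\cap E(H))$ with $G\in\mathcal{A}$, $H\in\mathcal{B}$. A class is $\chi$-bounded if there is a non-decreasing $f:\mathbb{N}\to\mathbb{N}$ with $\chi(G)\le f(\omega(G))$ for all members. A class $\mathcal{A}$ is intersectionwise $\chi$-guarding if for every $\chi$-bounded class $\mathcal{B}$ the graph-intersection of $\mathcal{A}$ and $\mathcal{B}$ is $\chi$-bounded. -}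

module Defs where

open import Data.Bool using (Bool; true; false; _∧_)
open import Data.Nat using (ℕ; suc; _≤_; _<_)
open import Data.Fin using (Fin)
open import Data.Fin.Properties using (_≟_)
open import Data.Product using (Σ; _×_; ∃; _,_)
open import Relation.Nullary using (¬_)
open import Relation.Nullary.Decidable using (⌊_⌋)
open import Relation.Binary.PropositionalEquality using (_≡_; _≢_)
open import Function.Definitions using (Injective)

record Graph : Set where
  field
    V       : ℕ → Bool
    E       : ℕ → ℕ → Bool
    bound   : Σ ℕ λ n → ∀ x → V x ≡ true → x < n
    E-sym   : ∀ x y → E x y ≡ E y x
    E-irr   : ∀ x → E x x ≡ false
    E-ends  : ∀ x y → E x y ≡ true → V x ≡ true
open Graph public

_[_] : Graph → (ℕ → Bool) → Graph
Graph.V (G [ S ]) x = V G x ∧ S x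
Graph.E (G [ S ]) x y = E G x y ∧ (S x ∧ S y)
Graph.bound (G [ S ]) with bound G
... | n , p = n , λ x q → p x (∧-l q)
  where
  ∧-l : ∀ {a b} → (a ∧ b) ≡ true → a ≡ true
  ∧-l {true} _ = Relation.Binary.PropositionalEquality.refl
Graph.E-sym (G [ S ]) x y rewrite E-sym G x y = cong-∧ (∧-comm' (S x) (S y))
  where
  open Relation.Binary.PropositionalEquality using (cong; refl)
  ∧-comm' : ∀ a b → (a ∧ b) ≡ (b ∧ a)
  ∧-comm' true true = refl
  ∧-comm' true false = refl
  ∧-comm' false true = refl
  ∧-comm' false false = refl
  cong-∧ : ∀ {c d} → c ≡ d → (E G y x ∧ c) ≡ (E G y x ∧ d)
  cong-∧ refl = refl
Graph.E-irr (G [ S ]) x rewrite E-irr G x = Relation.Binary.PropositionalEquality.refl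
Graph.E-ends (G [ S ]) x y p with E G x y in eq | S x | S y
... | true | true | true rewrite E-ends G x y eq = Relation.Binary.PropositionalEquality.refl

_⊓_ : Graph → Graph → Graph
Graph.V (G ⊓ H) x = V G x ∧ V H x
Graph.E (G ⊓ H) x y = E G x y ∧ E H x y
Graph.bound (G ⊓ H) with bound G
... | n , p = n , λ x q → p x (∧-l q)
  where
  ∧-l : ∀ {a b} → (a ∧ b) ≡ true → a ≡ true
  ∧-l {true} _ = Relation.Binary.PropositionalEquality.refl
Graph.E-sym (G ⊓ H) x y rewrite E-sym G x y | E-sym H x y = Relation.Binary.PropositionalEquality.refl
Graph.E-irr (G ⊓ H) x rewrite E-irr G x = Relation.Binary.PropositionalEquality.refl
Graph.E-ends (G ⊓ H) x y p with E G x y in eg | E H x y in eh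
... | true | true rewrite E-ends G x y eg | E-ends H x y eh = Relation.Binary.PropositionalEquality.refl

SameGraph : Graph → Graph → Set
SameGraph G H = (∀ x → V G x ≡ V H x) × (∀ x y → E G x y ≡ E H x y)

Iso : Graph → Graph → Set
Iso G H = Σ (ℕ → ℕ) λ φ → Σ (ℕ → ℕ) λ ψ →
    (∀ x → V G x ≡ true → V H (φ x) ≡ true)
  × (∀ y → V H y ≡ true → V G (ψ y) ≡ true)
  × (∀ x → V G x ≡ true → ψ (φ x) ≡ x)
  × (∀ y → V H y ≡ true → φ (ψ y) ≡ y)
  × (∀ x y → V G x ≡ true → V G y ≡ true → E H (φ x) (φ y) ≡ E G x y)

record GraphClass : Set₁ where
  field
    _∋_       : Graph → Set
    iso-closed : ∀ G H → Iso G H → _∋_ G → _∋_ H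
    hereditary : ∀ G S → _∋_ G → _∋_ (G [ S ])
open GraphClass public

Colorable : Graph → ℕ → Set
Colorable G c = Σ (ℕ → Fin c) λ col →
  ∀ x y → E G x y ≡ true → col x ≢ col y

HasClique : Graph → ℕ → Set
HasClique G w = Σ (Fin w → ℕ) λ v →
  Injective _≡_ _≡_ v × (∀ i → V G (v i) ≡ true)
  × (∀ i j → i ≢ j → E G (v i) (v j) ≡ true)

IsCliqueNumber : Graph → ℕ → Set
IsCliqueNumber G w = HasClique G w × ¬ HasClique G (suc w)

χ-Bounded : (Graph → Set) → Set
χ-Bounded P = Σ (ℕ → ℕ) λ f → (∀ {a b} → a ≤ b → f a ≤ f b) ×
  (∀ G → P G → ∀ w → IsCliqueNumber G w → Colorable G (f w))

GraphIntersection : GraphClass → GraphClass → Graph → Set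
GraphIntersection A B K = Σ Graph λ G → Σ Graph λ H →
  (A ∋ G) × (B ∋ H) × SameGraph K (G ⊓ H)

IntersectionwiseχGuarding : GraphClass → Set₁
IntersectionwiseχGuarding A =
  (B : GraphClass) → χ-Bounded (_∋_ B) → χ-Bounded (GraphIntersection A B)

preimage : ∀ {k} → (ℕ → Fin k) → Fin k → ℕ → Bool
preimage f j x = ⌊ f x ≟ j ⌋

{-# OPTIONS --safe #-}
module Submission where

-- A graph in the graph-intersection of C and a χ-bounded class B is G ⊓ H with G ∈ C,
-- H ∈ B.  Colouring G by f cuts G ⊓ H into k induced pieces G[f⁻¹(j)] ⊓ H, each in the
-- graph-intersection of some Cᵢ with B, hence χ-bounded by gᵢ.  Each piece has clique
-- number at most ω(G ⊓ H) = w (it has an exact clique number, since finiteness makes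
-- clique existence decidable), so it is coloured with at most Σᵢ gᵢ(w) colours, and
-- pairing the piece index with the colour inside the piece gives a proper colouring
-- with k · Σᵢ gᵢ(w) colours.

open import Defs
open import Data.Bool using (true; _∧_)
open import Data.Bool.Properties using (∧-assoc; ∧-comm)
import Data.Bool.Properties as Bool
open import Data.Nat using (ℕ; zero; suc; _≤_; _≥_; _+_; _*_; z≤n)
open import Data.Nat.Properties using (≤-refl; m≤n⇒m≤1+n; m≤m+n; m≤n⇒m≤o+n; +-mono-≤; *-monoʳ-≤)
import Data.Nat.Properties as ℕ
open import Data.Fin using (Fin; toℕ; fromℕ<; inject≤; combine)
open import Data.Fin.Properties using (any?; all?; toℕ-fromℕ<; inject≤-injective; combine-injective)
import Data.Fin.Properties as Fin
open import Data.Vec using (Vec; []; _∷_; lookup; tabulate)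
open import Data.Vec.Properties using (lookup∘tabulate)
open import Data.Product using (Σ; ∃; _×_; _,_; proj₁; proj₂; map₂)
open import Function using (_∘_)
open import Function.Definitions using (Injective)
open import Relation.Nullary using (¬_; Dec; yes; no; ¬?)
open import Relation.Nullary.Decidable using (map′; _×-dec_; _→-dec_; dec-true; isYes≗does)
open import Relation.Unary using (Decidable)
open import Relation.Binary.PropositionalEquality using (_≡_; _≢_; refl; sym; trans; cong; subst; subst₂)

∧-trueˡ : ∀ {a b} → a ∧ b ≡ true → a ≡ true
∧-trueˡ {true} _ = refl

∧-true : ∀ {a b} → a ≡ true → b ≡ true → a ∧ b ≡ true
∧-true refl refl = refl

∧-swapʳ : ∀ a b c → (a ∧ b) ∧ c ≡ (a ∧ c) ∧ b
∧-swapʳ a b c = trans (∧-assoc a b c) (trans (cong (a ∧_) (∧-comm b c)) (sym (∧-assoc a c b)))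

anyVec? : ∀ {n} w {P : Vec (Fin n) w → Set} → Decidable P → Dec (∃ P)
anyVec? zero    P? = map′ ([] ,_) (λ { ([] , p) → p }) (P? [])
anyVec? (suc w) P? =
  map′ (λ { (x , xs , p) → x ∷ xs , p }) (λ { (x ∷ xs , p) → x , xs , p })
       (any? λ x → anyVec? w (P? ∘ (x ∷_)))

IsClique : ∀ {w} → Graph → (Fin w → ℕ) → Set
IsClique G v = Injective _≡_ _≡_ v × (∀ i → V G (v i) ≡ true)
  × (∀ i j → i ≢ j → E G (v i) (v j) ≡ true)

isClique? : ∀ {w} G (v : Fin w → ℕ) → Dec (IsClique G v)
isClique? G v = injective? ×-dec (all? λ i → V G (v i) Bool.≟ true)
  ×-dec (all? λ i → all? λ j → ¬? (i Fin.≟ j) →-dec (E G (v i) (v j) Bool.≟ true))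
  where
  injective? : Dec (Injective _≡_ _≡_ v)
  injective? = map′ (λ inj {i} {j} → inj i j) (λ inj i j → inj)
    (all? λ i → all? λ j → (v i ℕ.≟ v j) →-dec (i Fin.≟ j))

IsClique-cong : ∀ {w} G {u v : Fin w → ℕ} → (∀ i → u i ≡ v i) → IsClique G u → IsClique G v
IsClique-cong G u≗v (inj , vert , adj) =
    (λ {i} {j} vᵢ≡vⱼ → inj (trans (u≗v i) (trans vᵢ≡vⱼ (sym (u≗v j)))))
  , (λ i → subst (λ x → V G x ≡ true) (u≗v i) (vert i))
  , (λ i j i≢j → subst₂ (λ x y → E G x y ≡ true) (u≗v i) (u≗v j) (adj i j i≢j))

-- Vertices lie below the bound n, so a clique can be searched among vectors over Fin n.
hasClique? : ∀ G w → Dec (HasClique G w)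
hasClique? G w with bound G
... | n , below = map′ fromVec toVec (anyVec? w (isClique? G ∘ toClique))
  where
  toClique : Vec (Fin n) w → Fin w → ℕ
  toClique xs = toℕ ∘ lookup xs
  fromVec : ∃ (IsClique G ∘ toClique) → HasClique G w
  fromVec (xs , clique) = toClique xs , clique
  toVec : HasClique G w → ∃ (IsClique G ∘ toClique)
  toVec (v , clique@(_ , vert , _)) = xs , IsClique-cong G (sym ∘ toClique-xs) clique
    where
    xs : Vec (Fin n) w
    xs = tabulate λ i → fromℕ< (below (v i) (vert i))
    toClique-xs : ∀ i → toClique xs i ≡ v i
    toClique-xs i = trans (cong toℕ (lookup∘tabulate _ i)) (toℕ-fromℕ< _)

hasClique-0 : ∀ G → HasClique G 0
hasClique-0 G = (λ ()) , (λ { {()} }) , (λ ()) , (λ ())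

cliqueNumber-≤ : ∀ G m → ¬ HasClique G (suc m) → ∃ λ w → w ≤ m × IsCliqueNumber G w
cliqueNumber-≤ G zero    ¬K₁ = 0 , z≤n , hasClique-0 G , ¬K₁
cliqueNumber-≤ G (suc m) ¬K₂₊ₘ with hasClique? G (suc m)
... | yes K₁₊ₘ = suc m , ≤-refl , K₁₊ₘ , ¬K₂₊ₘ
... | no ¬K₁₊ₘ with cliqueNumber-≤ G m ¬K₁₊ₘ
...   | w , w≤m , ω≡w = w , m≤n⇒m≤1+n w≤m , ω≡w

HasClique-[] : ∀ K S {w} → HasClique (K [ S ]) w → HasClique K w
HasClique-[] K S (v , inj , vert , adj) = v , inj , ∧-trueˡ ∘ vert , λ i j i≢j → ∧-trueˡ (adj i j i≢j)

SameGraph-[] : ∀ K G H S → SameGraph K (G ⊓ H) → SameGraph (K [ S ]) ((G [ S ]) ⊓ H)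
SameGraph-[] K G H S (V≡ , E≡) = V≡ₛ , E≡ₛ
  where
  V≡ₛ : ∀ x → V K x ∧ S x ≡ (V G x ∧ S x) ∧ V H x
  V≡ₛ x = trans (cong (_∧ S x) (V≡ x)) (∧-swapʳ (V G x) (V H x) (S x))
  E≡ₛ : ∀ x y → E K x y ∧ (S x ∧ S y) ≡ (E G x y ∧ (S x ∧ S y)) ∧ E H x y
  E≡ₛ x y = trans (cong (_∧ (S x ∧ S y)) (E≡ x y)) (∧-swapʳ (E G x y) (E H x y) (S x ∧ S y))

Colorable-mono : ∀ G {c d} → c ≤ d → Colorable G c → Colorable G d
Colorable-mono G c≤d (col , proper) =
  (λ x → inject≤ (col x) c≤d) , λ x y xy eq → proper x y xy (inject≤-injective c≤d c≤d _ _ eq)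

preimage-∋ : ∀ {k x j} (f : ℕ → Fin k) → f x ≡ j → preimage f j x ≡ true
preimage-∋ {x = x} {j} f fx≡j = trans (isYes≗does (f x Fin.≟ j)) (dec-true (f x Fin.≟ j) fx≡j)

Colorable-by-parts : ∀ {k c} K (f : ℕ → Fin k) → (∀ j → Colorable (K [ preimage f j ]) c)
  → Colorable K (k * c)
Colorable-by-parts K f colorᵢ = color , proper
  where
  colorIn : ∀ j → ℕ → Fin _
  colorIn j = proj₁ (colorᵢ j)
  color : ℕ → Fin _
  color x = combine (f x) (colorIn (f x) x)
  proper-in-part : ∀ {x y} j → f x ≡ j → f y ≡ j → E K x y ≡ true → colorIn j x ≢ colorIn j y
  proper-in-part {x} {y} j fx≡j fy≡j xy =
    proj₂ (colorᵢ j) x y (∧-true xy (∧-true (preimage-∋ f fx≡j) (preimage-∋ f fy≡j)))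
  proper : ∀ x y → E K x y ≡ true → color x ≢ color y
  proper x y xy eq with combine-injective (f x) _ (f y) _ eq
  ... | fx≡fy , same = proper-in-part (f x) refl (sym fx≡fy) xy
    (subst (λ j → colorIn (f x) x ≡ colorIn j y) (sym fx≡fy) same)

sumᶠ : ∀ {t} → (Fin t → ℕ) → ℕ
sumᶠ {zero}  g = 0
sumᶠ {suc t} g = g Fin.zero + sumᶠ (g ∘ Fin.suc)

≤-sumᶠ : ∀ {t} (g : Fin t → ℕ) i → g i ≤ sumᶠ g
≤-sumᶠ g Fin.zero    = m≤m+n _ _
≤-sumᶠ g (Fin.suc i) = m≤n⇒m≤o+n (g Fin.zero) (≤-sumᶠ (g ∘ Fin.suc) i)

sumᶠ-mono-≤ : ∀ {t} {g h : Fin t → ℕ} → (∀ i → g i ≤ h i) → sumᶠ g ≤ sumᶠ h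
sumᶠ-mono-≤ {zero}  g≤h = ≤-refl
sumᶠ-mono-≤ {suc t} g≤h = +-mono-≤ (g≤h Fin.zero) (sumᶠ-mono-≤ (g≤h ∘ Fin.suc))

χ-Bounded-colorable : ∀ {P} (χP : χ-Bounded P) {K w} → P K → ¬ HasClique K (suc w)
  → Colorable K (proj₁ χP w)
χ-Bounded-colorable (g , g-mono , g-colors) {K} {w} PK ¬K₁₊w with cliqueNumber-≤ K w ¬K₁₊w
... | w′ , w′≤w , ω≡w′ = Colorable-mono K (g-mono w′≤w) (g-colors K PK w′ ω≡w′)

PartitionableInto : ∀ {t} → ℕ → (Fin t → Graph → Set) → Graph → Set
PartitionableInto k Ps K = Σ (ℕ → Fin k) λ f → (j : Fin k) → ∃ λ i → Ps i (K [ preimage f j ])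

χ-Bounded-by-partition : ∀ {k t} {P : Graph → Set} {Ps : Fin t → Graph → Set}
  → (∀ i → χ-Bounded (Ps i)) → (∀ K → P K → PartitionableInto k Ps K) → χ-Bounded P
χ-Bounded-by-partition {k} {t} {P} χPs partition = colors , colors-mono , colors-suffice
  where
  g : Fin t → ℕ → ℕ
  g i = proj₁ (χPs i)
  colors : ℕ → ℕ
  colors w = k * sumᶠ (λ i → g i w)
  colors-mono : ∀ {a b} → a ≤ b → colors a ≤ colors b
  colors-mono a≤b = *-monoʳ-≤ k (sumᶠ-mono-≤ λ i → proj₁ (proj₂ (χPs i)) a≤b)
  colors-suffice : ∀ K → P K → ∀ w → IsCliqueNumber K w → Colorable K (colors w)
  colors-suffice K PK w (_ , ¬K₁₊w) with partition K PK
  ... | f , parts = Colorable-by-parts K f part-colorable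
    where
    part-colorable : ∀ j → Colorable (K [ preimage f j ]) (sumᶠ λ i → g i w)
    part-colorable j with parts j
    ... | i , PᵢKⱼ = Colorable-mono (K [ preimage f j ]) (≤-sumᶠ (λ i → g i w) i)
      (χ-Bounded-colorable (χPs i) PᵢKⱼ (¬K₁₊w ∘ HasClique-[] K (preimage f j)))

proposition3p7 : (k t : ℕ) → k ≥ 1 → (Cs : Fin t → GraphClass) → (C : GraphClass)
    → (∀ i → IntersectionwiseχGuarding (Cs i))
    → (∀ G → C ∋ G → Σ (ℕ → Fin k) λ f → (j : Fin k) → ∃ λ (i : Fin t) → Cs i ∋ (G [ preimage f j ]))
    → IntersectionwiseχGuarding C
proposition3p7 k t _ Cs C guarding partition B χB =
  χ-Bounded-by-partition (λ i → guarding i B χB) partition-C⊓B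
  where
  partition-C⊓B : ∀ K → GraphIntersection C B K
    → PartitionableInto k (λ i → GraphIntersection (Cs i) B) K
  partition-C⊓B K (G , H , CG , BH , K≡G⊓H) with partition G CG
  ... | f , parts = f , λ j → map₂ (λ CᵢGⱼ → G [ preimage f j ] , H , CᵢGⱼ , BH ,
                                     SameGraph-[] K G H (preimage f j) K≡G⊓H) (parts j)
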